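{- Let $T$ be a string, $\phi(i,j,w)$ an edit operation, $L=T[1..i-1]$, $R=T[j+1..|T|]$ and $T'=LwR$, with $|L|\ge|R|$, $|w|\le |L|/2$, and such that the longest border of $Lw$ is longer than $|w|$. Suppose $T'$ has a border longer than $R$, and let $b^\star$ be the border of $Lw$ such that $b^\star R$ is the longest border of $T'$. Partition the set of borders of $Lw$ into groups $G_1,\dots,G_m$ such that all borders in a group have the same smallest period and $p_k$ (the period of borders in $G_k$) satisfies $p_k>p_{k+1}$; let $k^\star$ be the index with $b^\star\in G_{k^\star}$. For each $k$, let $\alpha_k$ be the exponent of the longest prefix of $T'$ with period $p_k$. If $b^\star$ is periodic and $p_{k^\star} = \mathsf{per}(b^\star R)$, then $|b^\star| \le \alpha_{k^\star}p_{k^\star} - |R|$.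
   Context: A border of a non-empty string $S$ is a string that is both a proper prefix and a proper suffix of $S$. If $S$ has a border $b$, $|S|-|b|$ is a period of $S$; $\mathsf{per}(S)$ is the smallest period. The exponent of $S$ is $|S|/\mathsf{per}(S)$ (so the longest prefix of $T'$ with period $p_k$ has length $\alpha_k p_k$). $S$ is periodic if $\mathsf{per}(S)\le |S|/2$. The edit $\phi(i,j,w)$ with $1\le j\le |T|$, $1\le i\le j+1$ produces $T'=T[1..i-1]\,w\,T[j+1..|T|]$ (substitution of $T[i..j]$ by $w$ if $i\le j$, insertion after $T[i-1]$ if $i=j+1$). -}

module Defs where

open import Data.Nat using (ℕ; _+_; _*_; _∸_; _≤_; _<_)
open import Data.List using (List; _++_; length; take; drop)
open import Data.Product using (Σ; ∃; _×_)
open import Relation.Binary.PropositionalEquality using (_≡_)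

module _ {A : Set} where

  Prefix : List A → List A → Set
  Prefix b S = ∃ λ u → b ++ u ≡ S

  Suffix : List A → List A → Set
  Suffix b S = ∃ λ u → u ++ b ≡ S

  Border : List A → List A → Set
  Border b S = length b < length S × Prefix b S × Suffix b S

  LongestBorder : List A → List A → Set
  LongestBorder b S = Border b S × (∀ c → Border c S → length c ≤ length b)

  Period : ℕ → List A → Set
  Period p S = ∃ λ b → Border b S × length S ≡ p + length b

  IsPer : ℕ → List A → Set
  IsPer p S = Period p S × (∀ q → Period q S → p ≤ q)

  LongestPrefixWithPeriod : ℕ → ℕ → List A → Set
  LongestPrefixWithPeriod ℓ p S =
    ℓ ≤ length S × Period p (take ℓ S)
    × (∀ ℓ' → ℓ' ≤ length S → Period p (take ℓ' S) → ℓ' ≤ ℓ)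

  -- the edit φ(i,j,w) on T (1-indexed): T' = L w R
  EditL : ℕ → List A → List A
  EditL i T = take (i ∸ 1) T

  EditR : ℕ → List A → List A
  EditR j T = drop j T

{-# OPTIONS --safe #-}
module Submission where

open import Defs
open import Data.Nat using (ℕ; _+_; _*_; _≤_; _<_)
open import Data.List using (List; []; _∷_; _++_; length; take)
open import Data.List.Properties using (length-++; length-++-≤ˡ)
open import Data.Product using (∃; _×_; _,_)
open import Relation.Binary.PropositionalEquality using (_≡_; refl; cong; sym; subst)

module _ {A : Set} where

  take-length-++ : (xs ys : List A) → take (length xs) (xs ++ ys) ≡ xs
  take-length-++ []       ys = refl
  take-length-++ (x ∷ xs) ys = cong (x ∷_) (take-length-++ xs ys)

  Prefix⇒length-≤ : {b S : List A} → Prefix b S → length b ≤ length S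
  Prefix⇒length-≤ {b} (_ , refl) = length-++-≤ˡ b

  Prefix⇒take-length≡ : {b S : List A} → Prefix b S → take (length b) S ≡ b
  Prefix⇒take-length≡ {b} (u , refl) = take-length-++ b u

  Border⇒Prefix : {b S : List A} → Border b S → Prefix b S
  Border⇒Prefix (_ , prefix , _) = prefix

  prefix-with-period-≤-longest : {ℓ p : ℕ} {b S : List A} →
    Prefix b S → Period p b → LongestPrefixWithPeriod ℓ p S → length b ≤ ℓ
  prefix-with-period-≤-longest {p = p} prefix period (_ , _ , longest) =
    longest _ (Prefix⇒length-≤ prefix)
      (subst (Period p) (sym (Prefix⇒take-length≡ prefix)) period)

-- Only three hypotheses matter: b⋆R is a border, hence a prefix, of T', and it
-- has period p, so it is one of the prefixes over which ℓ is the maximum.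
lemma9 : {A : Set} (T w : List A) (i j : ℕ) →
    1 ≤ j → j ≤ length T → 1 ≤ i → i ≤ j + 1 →
    length (EditR j T) ≤ length (EditL i T) →
    2 * length w ≤ length (EditL i T) →
    (∃ λ b → LongestBorder b (EditL i T ++ w) × length w < length b) →
    (∃ λ b → Border b (EditL i T ++ w ++ EditR j T) × length (EditR j T) < length b) →
    (bstar : List A) →
    Border bstar (EditL i T ++ w) →
    LongestBorder (bstar ++ EditR j T) (EditL i T ++ w ++ EditR j T) →
    (p : ℕ) → IsPer p bstar →
    2 * p ≤ length bstar →
    IsPer p (bstar ++ EditR j T) →
    (ℓ : ℕ) → LongestPrefixWithPeriod ℓ p (EditL i T ++ w ++ EditR j T) →
    length bstar + length (EditR j T) ≤ ℓ
lemma9 T w i j _ _ _ _ _ _ _ _ bstar _ (border , _) p _ _ (period , _) ℓ longest =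
  subst (_≤ ℓ) (length-++ bstar)
    (prefix-with-period-≤-longest (Border⇒Prefix border) period longest)
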